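{- Let $\Delta=d(n_1,l_1)$ and $\delta=d(n_2,l_2)$ be two deletes. If $\Delta\sqsubset\delta$, put $\Delta(\delta)=\delta\uparrow\Delta$ and $\delta(\Delta)=\Delta$; if $\Delta\sqsupset\delta$, put $\Delta(\delta)=\delta$ and $\delta(\Delta)=\Delta\uparrow\delta$. Then in either case, for every string $t$ to which both $\Delta$ and $\delta$ can be applied, the string obtained from $t$ by applying $\Delta$ and then $\Delta(\delta)$ is defined and equals the string obtained from $t$ by applying $\delta$ and then $\delta(\Delta)$.
   Context: $\Sigma$ is a non-empty finite alphabet; a string is a finite or countably infinite sequence of characters of $\Sigma$, positions being numbered $0,1,2,\dots$, and $|t|$ is its length. A delete is a diff $d(n,l)$ with $n\in\mathbb{N}$, $l\ge 1$; applying $d(n,l)$ to $t$ is possible when $n+l\le|t|$ and yields $t$ with the characters at positions $n,\dots,n+l-1$ removed. Endpoints: $\ulcorner d(n,l)=n$, $d(n,l)^{\urcorner}=n+l-1$. Relations: $\Delta\sqsubset\delta$ iff $\Delta^{\urcorner}<\ulcorner\delta$; $\Delta\sqsupset\delta$ iff $\ulcorner\Delta>\delta^{\urcorner}$. Lifting: for a delete $X=d(n_2,l)$ and a delete $Y=d(n_1,l_1)$ with $n_1\le n_2$, $X\uparrow Y=d(n_2-l_1,l)$. -}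

module Defs where

open import Data.Nat using (ℕ; _+_; _∸_; _≤_; _<_; _<ᵇ_)
open import Data.Bool using (if_then_else_)
open import Data.List using (List; length; take; drop; _++_)
open import Data.Unit using (⊤)
open import Data.Empty using (⊥)
open import Data.Product using (_×_)
open import Relation.Binary.PropositionalEquality using (_≡_)

data Str (A : Set) : Set where
  fin : List A → Str A
  inf : (ℕ → A) → Str A

_≈_ : {A : Set} → Str A → Str A → Set
fin xs ≈ fin ys = xs ≡ ys
fin _  ≈ inf _  = ⊥
inf _  ≈ fin _  = ⊥
inf f  ≈ inf g  = ∀ i → f i ≡ g i

record Delete : Set where
  constructor d
  field
    pos : ℕ
    len : ℕ
    len≥1 : 1 ≤ len
open Delete public

⌜_ : Delete → ℕ
⌜ x = pos x

_⌝ : Delete → ℕ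
x ⌝ = pos x + len x ∸ 1

_⊏_ : Delete → Delete → Set
Δ ⊏ δ = Δ ⌝ < ⌜ δ

_⊐_ : Delete → Delete → Set
Δ ⊐ δ = δ ⌝ < ⌜ Δ

-- Lifting: d(n₂,l) ↑ d(n₁,l₁) = d(n₂ - l₁, l)  (used only when n₁ ≤ n₂;
-- in the theorem's cases n₂ - l₁ is an honest difference).
_↑_ : Delete → Delete → Delete
X ↑ Y = d (pos X ∸ len Y) (len X) (len≥1 X)

CanApply : {A : Set} → Delete → Str A → Set
CanApply x (fin xs) = pos x + len x ≤ length xs
CanApply x (inf _)  = ⊤

apply : {A : Set} → Delete → Str A → Str A
apply x (fin xs) = fin (take (pos x) xs ++ drop (pos x + len x) xs)
apply x (inf f)  = inf (λ i → if i <ᵇ pos x then f i else f (i + len x))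

module Submission where

-- Write the left delete as X = d(a,l) and the right
-- one as Y = d(a+l+c,m), where c is the gap between them; then Y ↑ X is
-- d(a+c,m), and both orders remove exactly the blocks [a,a+l) and
-- [a+l+c,a+l+c+m) of the original string.
--
-- Applicability of the second
-- delete follows from "deleting l characters shortens a list by l".
-- The theorem then reduces the case Δ ⊏ δ to this by extracting the gap,
-- and the case Δ ⊐ δ to the first one with the roles of Δ and δ exchanged.

open import Defs
open import Data.Nat using (ℕ; suc; zero; _+_; _∸_; _≤_; _<_; _<ᵇ_)
open import Data.Nat.Properties
open import Data.Fin using (Fin)
open import Data.Bool using (true; false; if_then_else_)
open import Data.Product using (_×_; _,_; ∃)
open import Data.List using (List; []; _∷_; length; take; drop; _++_)
open import Data.List.Properties using (length-++; length-take; length-drop; take-[]; drop-[])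
open import Data.Unit using (tt)
open import Relation.Binary.PropositionalEquality
open import Relation.Nullary using (contradiction; yes; no)
open import Relation.Nullary.Reflects using (ofʸ; ofⁿ)
open import Algebra.Properties.CommutativeSemigroup +-commutativeSemigroup
  using () renaming (xy∙z≈xz∙y to +-rightComm)

≈-sym : {A : Set} (s u : Str A) → s ≈ u → u ≈ s
≈-sym (fin _) (fin _) e = sym e
≈-sym (inf _) (inf _) e = λ i → sym (e i)

CommuteVia : {A : Set} → Delete → Delete → Delete → Str A → Set
CommuteVia X Y Y′ t =
  CanApply Y′ (apply X t) × CanApply X (apply Y t) × (apply Y′ (apply X t) ≈ apply X (apply Y t))

cut : {A : Set} → ℕ → ℕ → List A → List A
cut a l xs = take a xs ++ drop (a + l) xs

length-cut : {A : Set} (a l : ℕ) (xs : List A) → a + l ≤ length xs →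
  length (cut a l xs) ≡ length xs ∸ l
length-cut a l xs a+l≤n = begin
    length (take a xs ++ drop (a + l) xs)
  ≡⟨ length-++ (take a xs) ⟩
    length (take a xs) + length (drop (a + l) xs)
  ≡⟨ cong₂ _+_ (trans (length-take a xs) (m≤n⇒m⊓n≡m (≤-trans (m≤m+n a l) a+l≤n)))
               (length-drop (a + l) xs) ⟩
    a + (length xs ∸ (a + l))
  ≡⟨ sym (+-∸-assoc a a+l≤n) ⟩
    (a + length xs) ∸ (a + l)
  ≡⟨ [m+n]∸[m+o]≡n∸o a (length xs) l ⟩
    length xs ∸ l ∎
  where open ≡-Reasoning

cut-drop : {A : Set} (l c m : ℕ) (xs : List A) →
  cut c m (drop l xs) ≡ drop l (cut (l + c) m xs)
cut-drop zero    c m xs       = refl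
cut-drop (suc l) c m []       = cong₂ _++_ (take-[] c) (drop-[] (c + m))
cut-drop (suc l) c m (x ∷ xs) = cut-drop l c m xs

cut-commute : {A : Set} (a l c m : ℕ) (xs : List A) →
  cut (a + c) m (cut a l xs) ≡ cut a l (cut (a + l + c) m xs)
cut-commute zero    l c m xs       = cut-drop l c m xs
cut-commute (suc a) l c m []       = refl
cut-commute (suc a) l c m (x ∷ xs) = cong (x ∷_) (cut-commute a l c m xs)

-- Deleting l characters at position a from an infinite string
-- (definitionally the position map of  apply (d a l _) (inf f)).
skip : {A : Set} → ℕ → ℕ → (ℕ → A) → ℕ → A
skip a l f i = if i <ᵇ a then f i else f (i + l)

skip-below : {A : Set} {a i : ℕ} (l : ℕ) (f : ℕ → A) → i < a → skip a l f i ≡ f i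
skip-below {a = a} {i} l f i<a with i <ᵇ a | <ᵇ-reflects-< i a
... | true  | _       = refl
... | false | ofⁿ i≮a = contradiction i<a i≮a

skip-above : {A : Set} {a i : ℕ} (l : ℕ) (f : ℕ → A) → a ≤ i → skip a l f i ≡ f (i + l)
skip-above {a = a} {i} l f a≤i with i <ᵇ a | <ᵇ-reflects-< i a
... | false | _       = refl
... | true  | ofʸ i<a = contradiction a≤i (<⇒≱ i<a)

skip-commute : {A : Set} (a l c m : ℕ) (f : ℕ → A) (i : ℕ) →
  skip (a + c) m (skip a l f) i ≡ skip a l (skip (a + l + c) m f) i
skip-commute a l c m f i with i <? a | i <? a + c
... | yes i<a | _ = begin
    skip (a + c) m (skip a l f) i   ≡⟨ skip-below m (skip a l f) (≤-trans i<a (m≤m+n a c)) ⟩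
    skip a l f i                    ≡⟨ skip-below l f i<a ⟩
    f i                             ≡⟨ skip-below m f (≤-trans i<a (≤-trans (m≤m+n a l) (m≤m+n (a + l) c))) ⟨
    skip (a + l + c) m f i          ≡⟨ skip-below l (skip (a + l + c) m f) i<a ⟨
    skip a l (skip (a + l + c) m f) i ∎
  where open ≡-Reasoning
... | no i≮a | yes i<a+c = begin
    skip (a + c) m (skip a l f) i   ≡⟨ skip-below m (skip a l f) i<a+c ⟩
    skip a l f i                    ≡⟨ skip-above l f (≮⇒≥ i≮a) ⟩
    f (i + l)                       ≡⟨ skip-below m f i+l<b ⟨
    skip (a + l + c) m f (i + l)    ≡⟨ skip-above l (skip (a + l + c) m f) (≮⇒≥ i≮a) ⟨
    skip a l (skip (a + l + c) m f) i ∎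
  where
    open ≡-Reasoning
    i+l<b : i + l < a + l + c
    i+l<b = subst (i + l <_) (+-rightComm a c l) (+-monoˡ-< l i<a+c)
... | no i≮a | no i≮a+c = begin
    skip (a + c) m (skip a l f) i   ≡⟨ skip-above m (skip a l f) (≮⇒≥ i≮a+c) ⟩
    skip a l f (i + m)              ≡⟨ skip-above l f (≤-trans (≮⇒≥ i≮a) (m≤m+n i m)) ⟩
    f (i + m + l)                   ≡⟨ cong f (+-rightComm i m l) ⟩
    f (i + l + m)                   ≡⟨ skip-above m f b≤i+l ⟨
    skip (a + l + c) m f (i + l)    ≡⟨ skip-above l (skip (a + l + c) m f) (≮⇒≥ i≮a) ⟨
    skip a l (skip (a + l + c) m f) i ∎
  where
    open ≡-Reasoning
    b≤i+l : a + l + c ≤ i + l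
    b≤i+l = subst (_≤ i + l) (+-rightComm a c l) (+-monoˡ-≤ l (≮⇒≥ i≮a+c))

gap-commute : {A : Set} (a l c m : ℕ) (p : 1 ≤ l) (q : 1 ≤ m) (t : Str A) →
  CanApply (d a l p) t → CanApply (d (a + l + c) m q) t →
  CommuteVia (d a l p) (d (a + l + c) m q) (d (a + c) m q) t
gap-commute a l c m p q (inf f)  _    _    = tt , tt , skip-commute a l c m f
gap-commute a l c m p q (fin xs) fitX fitY = fitY′ , fitX′ , cut-commute a l c m xs
  where
    fitY′ : a + c + m ≤ length (cut a l xs)
    fitY′ = subst (a + c + m ≤_) (sym (length-cut a l xs fitX))
      (m+n≤o⇒m≤o∸n (a + c + m) (subst (_≤ length xs) reorder fitY))
      where
        reorder : a + l + c + m ≡ a + c + m + l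
        reorder = trans (cong (_+ m) (+-rightComm a l c)) (+-rightComm (a + c) l m)
    fitX′ : a + l ≤ length (cut (a + l + c) m xs)
    fitX′ = subst (a + l ≤_) (sym (length-cut (a + l + c) m xs fitY))
      (m+n≤o⇒m≤o∸n (a + l) (≤-trans (+-monoˡ-≤ m (m≤m+n (a + l) c)) fitY))

⊏⇒gap : (X Y : Delete) → X ⊏ Y → ∃ λ c → pos X + len X + c ≡ pos Y
⊏⇒gap (d a l p) (d b m q) X⊏Y = b ∸ (a + l) , m+[n∸m]≡n a+l≤b
  where
    -- Since l ≥ 1, the successor of the right endpoint a + l ∸ 1 is a + l.
    after-end : suc (a + l ∸ 1) ≡ a + l
    after-end = trans (+-comm 1 (a + l ∸ 1)) (m∸n+n≡m (≤-trans p (m≤n+m l a)))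

    a+l≤b : a + l ≤ b
    a+l≤b = subst (_≤ b) after-end X⊏Y

⊏-commute : {A : Set} (X Y : Delete) (t : Str A) → X ⊏ Y →
  CanApply X t → CanApply Y t → CommuteVia X Y (Y ↑ X) t
⊏-commute X Y t X⊏Y with ⊏⇒gap X Y X⊏Y
⊏-commute (d a l p) (d .(a + l + c) m q) t _ | c , refl = λ fitX fitY →
  subst (λ Y′ → CommuteVia (d a l p) (d (a + l + c) m q) Y′ t)
        (cong (λ n → d n m q) (sym lifted-pos))
        (gap-commute a l c m p q t fitX fitY)
  where
    lifted-pos : a + l + c ∸ l ≡ a + c
    lifted-pos = trans (cong (_∸ l) (+-rightComm a l c)) (m+n∸n≡m (a + c) l)

mainTheorem5 : (k : ℕ) (Δ δ : Delete) (t : Str (Fin (suc k)))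
    → CanApply Δ t → CanApply δ t
    → (Δ ⊏ δ → CanApply (δ ↑ Δ) (apply Δ t) × CanApply Δ (apply δ t)
                 × (apply (δ ↑ Δ) (apply Δ t) ≈ apply Δ (apply δ t)))
      × (Δ ⊐ δ → CanApply δ (apply Δ t) × CanApply (Δ ↑ δ) (apply δ t)
                 × (apply δ (apply Δ t) ≈ apply (Δ ↑ δ) (apply δ t)))
mainTheorem5 k Δ δ t fitΔ fitδ = left , right
  where
    left : Δ ⊏ δ → CommuteVia Δ δ (δ ↑ Δ) t
    left Δ⊏δ = ⊏-commute Δ δ t Δ⊏δ fitΔ fitδ

    right : Δ ⊐ δ → CanApply δ (apply Δ t) × CanApply (Δ ↑ δ) (apply δ t)
                    × (apply δ (apply Δ t) ≈ apply (Δ ↑ δ) (apply δ t))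
    right δ⊏Δ with ⊏-commute δ Δ t δ⊏Δ fitδ fitΔ
    ... | fitΔ′ , fitδ′ , same =
      fitδ′ , fitΔ′ , ≈-sym (apply (Δ ↑ δ) (apply δ t)) (apply δ (apply Δ t)) same
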